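{- Let $R$ be a monotone transit function on a non-empty finite set $V$, and let $\mathscr{C}_R=\{R(x,y)\mid x,y\in V\}$. The following are equivalent: (i) $R$ satisfies (tb): for every $W\subseteq V$ with $|W|\ge 3$ there exists $x\in W$ such that for all $u,v\in W$, $R(x,u)\subseteq R(x,v)$ or $R(x,v)\subseteq R(x,u)$; (ii) $R$ satisfies (hc): for every $W\subseteq V$ with $|W|\ge 3$ there exist distinct $x,y\in W$ such that for all $u,v\in W$, ($R(x,u)\subseteq R(x,v)$ or $R(x,v)\subseteq R(x,u)$) and ($R(y,u)\subseteq R(y,v)$ or $R(y,v)\subseteq R(y,u)$); (iii) $R$ satisfies (tb'): whenever $v_1,\dots,v_n\in V$ with $n\ge 3$ satisfy $v_{k-1}\notin R(v_k,v_{k+1})$ and $v_{k+1}\notin R(v_{k-1},v_k)$ for all $k$ (indices modulo $n$), there exist $j$ with $1\le j\le n$ and $i\notin\{j,j-1\}$ such that $v_j\in R(v_i,v_{i+1})$; (iv) $\mathscr{C}_R$ is totally balanced.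
   Context: A transit function on $V$ is a map $R:V\times V\to 2^V$ with $u\in R(u,v)$, $R(u,v)=R(v,u)$, $R(u,u)=\{u\}$ for all $u,v$; it is monotone if $p,q\in R(u,v)$ implies $R(p,q)\subseteq R(u,v)$. A weak $\beta$-cycle in a set system $\mathscr{C}$ is a sequence of $n\ge 3$ sets $C_1,\dots,C_n\in\mathscr{C}$ together with vertices $x_1,\dots,x_n$ such that for all $i$, $x_i\in C_i\cap C_{i+1}$ and $x_i\notin C_k$ for every $k\notin\{i,i+1\}$ (indices modulo $n$). A set system is totally balanced ($\beta$-acyclic) if it contains no weak $\beta$-cycle. -}

module Defs where

open import Data.Nat using (ℕ; zero; suc; _+_; _∸_; _≥_)
open import Data.Nat.DivMod using (_mod_)
open import Data.Fin using (Fin; toℕ)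
open import Data.Fin.Subset using (Subset; _∈_; _∉_; _⊆_; ⁅_⁆; ∣_∣)
open import Data.Product using (Σ; ∃; ∃-syntax; _×_; _,_)
open import Data.Sum using (_⊎_)
open import Relation.Binary.PropositionalEquality using (_≡_; _≢_)
open import Relation.Nullary using (¬_)

TransitMap : ℕ → Set
TransitMap n = Fin n → Fin n → Subset n

IsTransitFunction : ∀ {n} → TransitMap n → Set
IsTransitFunction {n} R =
  (∀ (u v : Fin n) → u ∈ R u v) ×
  (∀ (u v : Fin n) → R u v ≡ R v u) ×
  (∀ (u : Fin n) → R u u ≡ ⁅ u ⁆)

IsMonotone : ∀ {n} → TransitMap n → Set
IsMonotone {n} R = ∀ (u v p q : Fin n) → p ∈ R u v → q ∈ R u v → R p q ⊆ R u v

next : ∀ {m} → Fin (suc m) → Fin (suc m)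
next {m} i = suc (toℕ i) mod (suc m)

prev : ∀ {m} → Fin (suc m) → Fin (suc m)
prev {m} i = (toℕ i + m) mod (suc m)

Comparable : ∀ {n} → TransitMap n → Subset n → Fin n → Set
Comparable {n} R W x =
  ∀ (u v : Fin n) → u ∈ W → v ∈ W → (R x u ⊆ R x v ⊎ R x v ⊆ R x u)

TB : ∀ {n} → TransitMap n → Set
TB {n} R = ∀ (W : Subset n) → ∣ W ∣ ≥ 3 → ∃[ x ] (x ∈ W × Comparable R W x)

HC : ∀ {n} → TransitMap n → Set
HC {n} R = ∀ (W : Subset n) → ∣ W ∣ ≥ 3 →
  ∃[ x ] ∃[ y ] (x ∈ W × y ∈ W × x ≢ y × Comparable R W x × Comparable R W y)

-- (tb'): sequences v_1..v_m with m ≥ 3, indexed by Fin (3 + k), indices mod m.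
TB' : ∀ {n} → TransitMap n → Set
TB' {n} R = ∀ (k : ℕ) (v : Fin (3 + k) → Fin n) →
  (∀ (j : Fin (3 + k)) →
     (v (prev j) ∉ R (v j) (v (next j))) × (v (next j) ∉ R (v (prev j)) (v j))) →
  ∃[ j ] ∃[ i ] (i ≢ j × i ≢ prev j × v j ∈ R (v i) (v (next i)))

SetSystem : ℕ → Set₁
SetSystem n = Subset n → Set

𝒞 : ∀ {n} → TransitMap n → SetSystem n
𝒞 {n} R C = ∃[ x ] ∃[ y ] (C ≡ R x y)

WeakBetaCycle : ∀ {n} → SetSystem n → Set
WeakBetaCycle {n} 𝒮 = ∃[ k ] Σ (Fin (3 + k) → Subset n) λ C → Σ (Fin (3 + k) → Fin n) λ x →
  (∀ i → 𝒮 (C i)) ×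
  (∀ i → x i ∈ C i × x i ∈ C (next i)) ×
  (∀ i l → l ≢ i → l ≢ next i → x i ∉ C l)

TotallyBalanced : ∀ {n} → SetSystem n → Set
TotallyBalanced 𝒮 = ¬ WeakBetaCycle 𝒮

{-# OPTIONS --safe #-}
-- By monotonicity every set of 𝒞_R is R-convex, so in a weak β-cycle x_{k-1} ∉ R(x_k, x_{k+1}) and
-- x_{k+1} ∉ R(x_{k-1}, x_k): no vertex of the cycle is a comparable point of its vertex set, and the
-- cycle violates (tb'). Conversely, a cyclic sequence violating (tb') makes the sets R(v_i, v_{i+1})
-- with the vertices v_{i+1} a weak β-cycle. This gives (tb) ⇒ (iv) ⇔ (iii), and (hc) ⇒ (tb) is trivial.
--
-- The substance is (iv) ⇒ (hc). Call y ∈ W a nest point of W if the traces on W of the sets of 𝒞_R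
-- through y form a chain; monotonicity makes a nest point a comparable point. If 𝒞_R is totally
-- balanced, every set e not covering W misses some nest point of W, by induction on W and, for fixed
-- W, downwards on the trace of e. When that trace is maximal, take k₀ ∈ W ∖ e and its component K in
-- W ∖ e, two vertices being adjacent when some set not covering W contains both. Along a chain of
-- such sets linked through K the traces on W ∩ e have a largest member, for otherwise the chain, cut
-- at the first set reaching a trace that the first set misses and shortcut at its chords, closes up
-- with e into a weak β-cycle. So one set h meeting K dominates the traces on W ∩ e of all sets
-- meeting K. Were every vertex of W ∩ e in such a set, h would strictly enlarge the trace of e.
-- Hence the vertices of K, together with those of W ∩ e lying in a set meeting K, form a proper
-- subset W′ of W, and a nest point of W′ outside e lies in K and is a nest point of W (if no set
-- meets K, then k₀ itself is a nest point). Applied to e = {x} and then to e = {y}, this yields two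
-- distinct nest points.

module Submission where

open import Defs
open import Level using (0ℓ)
open import Function using (_∘_; case_of_)
open import Function.Bundles using (_⇔_; mk⇔)
open import Data.Nat using (ℕ; zero; suc; _+_; _∸_; _≤_; _<_; z≤n; s≤s; _≟_; _≤?_)
open import Data.Nat.Properties
open import Data.Nat.DivMod using (_%_; m<n⇒m%n≡m; n%n≡0; [m+n]%n≡m%n)
open import Data.Nat.Induction using (<-rec)
import Induction.WellFounded as WF
open import Data.Fin as Fin using (Fin; zero; suc; toℕ; fromℕ; inject₁)
open import Data.Fin.Properties using (toℕ-fromℕ<; toℕ-fromℕ; toℕ-inject₁; toℕ<n; toℕ-injective; any?)
open import Data.Fin.Relation.Unary.Top using (view; ‵fromℕ; ‵inject₁)
open import Data.Product using (Σ; ∃; ∃-syntax; _×_; _,_; proj₁; proj₂)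
open import Data.Sum as Sum using (_⊎_; inj₁; inj₂)
open import Data.Empty using (⊥-elim)
open import Relation.Binary.PropositionalEquality using (_≡_; _≢_; refl; sym; trans; cong; subst; module ≡-Reasoning)
open import Relation.Binary.Definitions using (tri<; tri≈; tri>)
open import Relation.Nullary using (¬_; Dec; yes; no; does; contradiction; ¬?)
open import Relation.Nullary.Decidable using (_×-dec_; _⊎-dec_; dec-true; decidable-stable)
open import Relation.Unary using (Pred; Decidable)
open import Relation.Binary using (Rel) renaming (Decidable to Decidable₂)
import Relation.Binary.Construct.On as On
open import Relation.Binary.Construct.Closure.ReflexiveTransitive using (Star; ε; _◅_; _◅◅_)
open import Data.Fin.Subset using (Subset; _∈_; _∉_; _⊆_; _⊂_; _⊃_; _∩_; _∪_; _-_; ⁅_⁆; ⊥; ∣_∣)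
open import Data.Fin.Subset.Properties
  using (_∈?_; _⊆?_; _⊂?_; p⊆q⇒∣p∣≤∣q∣; ∣⊥∣≡0; ∣⁅x⁆∣≡1; ⊆-trans; p⊆p∪q; x∈p∪q⁺; x∈p∪q⁻; x∈p∩q⁺; x∈p∩q⁻; x∈⁅x⁆; x∈⁅y⁆⇒x≡y; x∈p⇒∣p-x∣<∣p∣; x∈p∧x≢y⇒x∈p-y)
open import Data.Fin.Subset.Induction using (⊂-wellFounded; ⊃-wellFounded)
open import Data.List using (List; []; _∷_; allFin; cartesianProduct)
open import Data.List.Relation.Unary.All as All using (All; []; _∷_)
open import Data.List.Membership.Propositional using () renaming (_∈_ to _∈ₗ_)
open import Data.List.Membership.Propositional.Properties using (∈-allFin; ∈-cartesianProduct⁺)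
open import Data.Vec using (tabulate)
open import Data.Vec.Properties using (lookup∘tabulate; lookup⇒[]=; []=⇒lookup)

next-inject₁ : ∀ {m} (i : Fin m) → next (inject₁ i) ≡ suc i
next-inject₁ {m} i = toℕ-injective (begin
  toℕ (next (inject₁ i))         ≡⟨ toℕ-fromℕ< _ ⟩
  suc (toℕ (inject₁ i)) % suc m  ≡⟨ cong (λ t → suc t % suc m) (toℕ-inject₁ i) ⟩
  suc (toℕ i) % suc m            ≡⟨ m<n⇒m%n≡m (s≤s (toℕ<n i)) ⟩
  suc (toℕ i)                    ∎)
  where open ≡-Reasoning

next-fromℕ : ∀ m → next (fromℕ m) ≡ zero
next-fromℕ m = toℕ-injective (begin
  toℕ (next (fromℕ m))         ≡⟨ toℕ-fromℕ< _ ⟩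
  suc (toℕ (fromℕ m)) % suc m  ≡⟨ cong (λ t → suc t % suc m) (toℕ-fromℕ m) ⟩
  suc m % suc m                ≡⟨ n%n≡0 (suc m) ⟩
  0                            ∎)
  where open ≡-Reasoning

prev-suc : ∀ {m} (i : Fin m) → prev (suc i) ≡ inject₁ i
prev-suc {m} i = toℕ-injective (begin
  toℕ (prev (suc i))         ≡⟨ toℕ-fromℕ< _ ⟩
  (suc (toℕ i) + m) % suc m  ≡⟨ cong (_% suc m) (sym (+-suc (toℕ i) m)) ⟩
  (toℕ i + suc m) % suc m    ≡⟨ [m+n]%n≡m%n (toℕ i) (suc m) ⟩
  toℕ i % suc m              ≡⟨ m<n⇒m%n≡m (m<n⇒m<1+n (toℕ<n i)) ⟩
  toℕ i                      ≡⟨ toℕ-inject₁ i ⟨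
  toℕ (inject₁ i)            ∎)
  where open ≡-Reasoning

prev-zero : ∀ m → prev (zero {m}) ≡ fromℕ m
prev-zero m = toℕ-injective (begin
  toℕ (prev (zero {m}))  ≡⟨ toℕ-fromℕ< _ ⟩
  m % suc m              ≡⟨ m<n⇒m%n≡m ≤-refl ⟩
  m                      ≡⟨ toℕ-fromℕ m ⟨
  toℕ (fromℕ m)          ∎)
  where open ≡-Reasoning

prev-next : ∀ {m} (i : Fin (suc m)) → prev (next i) ≡ i
prev-next i with view i
... | ‵fromℕ     = trans (cong prev (next-fromℕ _)) (prev-zero _)
... | ‵inject₁ j = trans (cong prev (next-inject₁ j)) (prev-suc j)

next-prev : ∀ {m} (i : Fin (suc m)) → next (prev i) ≡ i
next-prev zero    = trans (cong next (prev-zero _)) (next-fromℕ _)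
next-prev (suc i) = trans (cong next (prev-suc i)) (next-inject₁ i)

next-injective : ∀ {m} {i j : Fin (suc m)} → next i ≡ next j → i ≡ j
next-injective {i = i} {j} eq = trans (sym (prev-next i)) (trans (cong prev eq) (prev-next j))

next≢id : ∀ {m} (i : Fin (2 + m)) → next i ≢ i
next≢id i with view i
... | ‵fromℕ     = λ eq → 0≢1+n (cong toℕ (trans (sym (next-fromℕ _)) eq))
... | ‵inject₁ j = λ eq → 1+n≢n (trans (cong toℕ (trans (sym (next-inject₁ j)) eq)) (toℕ-inject₁ j))

next∘next≢id : ∀ {m} (i : Fin (3 + m)) → next (next i) ≢ i
next∘next≢id i with view i
... | ‵fromℕ = λ eq → 0≢1+n (suc-injective (cong toℕ (begin
  suc zero                ≡⟨ next-inject₁ zero ⟨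
  next zero               ≡⟨ cong next (next-fromℕ _) ⟨
  next (next (fromℕ _))   ≡⟨ eq ⟩
  fromℕ _                 ∎)))
  where open ≡-Reasoning
... | ‵inject₁ j with view j
...   | ‵fromℕ = λ eq → 0≢1+n (cong toℕ (begin
  zero                                  ≡⟨ next-fromℕ _ ⟨
  next (fromℕ _)                        ≡⟨ cong next (next-inject₁ (fromℕ _)) ⟨
  next (next (inject₁ (fromℕ _)))       ≡⟨ eq ⟩
  inject₁ (fromℕ _)                     ∎))
  where open ≡-Reasoning
...   | ‵inject₁ t = λ eq → m+1+n≢n 1 (begin
  suc (suc (toℕ t))                     ≡⟨ cong toℕ (trans (cong next (next-inject₁ (inject₁ t))) (next-inject₁ (suc t))) ⟨
  toℕ (next (next (inject₁ (inject₁ t)))) ≡⟨ cong toℕ eq ⟩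
  toℕ (inject₁ (inject₁ t))             ≡⟨ trans (toℕ-inject₁ _) (toℕ-inject₁ t) ⟩
  toℕ t                                 ∎)
  where open ≡-Reasoning

∃-least : ∀ {Q : Pred ℕ 0ℓ} → Decidable Q → ∀ {p} → Q p → ∃ λ l → l ≤ p × Q l × (∀ {i} → i < l → ¬ Q i)
∃-least Q? {zero} q₀ = 0 , z≤n , q₀ , λ ()
∃-least {Q} Q? {suc p} qₚ with Q? 0
... | yes q₀ = 0 , z≤n , q₀ , λ ()
... | no ¬q₀ with ∃-least {Q ∘ suc} (Q? ∘ suc) qₚ
...   | l , l≤p , qₗ , below = suc l , s≤s l≤p , qₗ , λ { {zero} _ → ¬q₀ ; {suc i} (s≤s i<l) → below i<l }

module _ {N : ℕ} {P : Pred (Fin N) 0ℓ} (P? : Decidable P) where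

  -- Opaque, since unfolding P? in membership goals makes type checking very slow.
  opaque
    select : Subset N
    select = tabulate (does ∘ P?)

    ∈-select⁺ : ∀ {x} → P x → x ∈ select
    ∈-select⁺ {x} px = lookup⇒[]= x select (trans (lookup∘tabulate _ x) (dec-true (P? x) px))

    ∈-select⁻ : ∀ {x} → x ∈ select → P x
    ∈-select⁻ {x} x∈ with P? x | trans (sym (lookup∘tabulate (does ∘ P?) x)) ([]=⇒lookup x∈)
    ... | yes px | _ = px

module _ {N : ℕ} where

  ⊈⇒∃ : ∀ {p q : Subset N} → ¬ p ⊆ q → ∃ λ x → x ∈ p × x ∉ q
  ⊈⇒∃ {p} {q} p⊈q with any? (λ x → x ∈? p ×-dec ¬? (x ∈? q))
  ... | yes witness = witness
  ... | no ∄ = contradiction (λ {x} x∈p → decidable-stable (x ∈? q) (λ x∉q → ∄ (x , x∈p , x∉q))) p⊈q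

  ⊆⇒∩⊆∩ : ∀ {U p q : Subset N} → U ⊆ q → U ∩ p ⊆ U ∩ q
  ⊆⇒∩⊆∩ {U} {p} U⊆q z∈ = x∈p∩q⁺ (proj₁ (x∈p∩q⁻ U p z∈) , U⊆q (proj₁ (x∈p∩q⁻ U p z∈)))

  ∩⊆∩-restrict : ∀ {U V p q : Subset N} → U ∩ p ⊆ V → V ∩ p ⊆ V ∩ q → U ∩ p ⊆ U ∩ q
  ∩⊆∩-restrict {U} {V} {p} {q} U∩p⊆V V∩p⊆V∩q z∈ with x∈p∩q⁻ U p z∈
  ... | z∈U , z∈p = x∈p∩q⁺ (z∈U , proj₂ (x∈p∩q⁻ V q (V∩p⊆V∩q (x∈p∩q⁺ (U∩p⊆V z∈ , z∈p)))))

  ∣q∣<∣p∣⇒p⊈q : ∀ {p q : Subset N} → ∣ q ∣ < ∣ p ∣ → ∃ λ x → x ∈ p × x ∉ q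
  ∣q∣<∣p∣⇒p⊈q ∣q∣<∣p∣ = ⊈⇒∃ (λ p⊆q → <⇒≱ ∣q∣<∣p∣ (p⊆q⇒∣p∣≤∣q∣ p⊆q))

  3≤∣p∣ : ∀ {p : Subset N} {a b c} → a ∈ p → b ∈ p → c ∈ p → a ≢ b → a ≢ c → b ≢ c → 3 ≤ ∣ p ∣
  3≤∣p∣ {p} {a} {b} {c} a∈p b∈p c∈p a≢b a≢c b≢c =
    ≤-trans (s≤s (≤-trans (s≤s (≤-trans (s≤s z≤n) (x∈p⇒∣p-x∣<∣p∣ c∈p-a-b))) (x∈p⇒∣p-x∣<∣p∣ b∈p-a)))
            (x∈p⇒∣p-x∣<∣p∣ a∈p)
    where
    b∈p-a : b ∈ p - a
    b∈p-a = x∈p∧x≢y⇒x∈p-y b∈p (a≢b ∘ sym)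
    c∈p-a-b : c ∈ p - a - b
    c∈p-a-b = x∈p∧x≢y⇒x∈p-y (x∈p∧x≢y⇒x∈p-y c∈p (a≢c ∘ sym)) (b≢c ∘ sym)

module Reachability {N : ℕ} (_⟶_ : Rel (Fin N) 0ℓ) (_⟶?_ : Decidable₂ _⟶_) (x₀ : Fin N) where

  Reached : Subset N → Set
  Reached A = ∀ {z} → z ∈ A → Star _⟶_ x₀ z

  Closed : Subset N → Set
  Closed A = ∀ {y z} → y ∈ A → y ⟶ z → z ∈ A

  Successor : Subset N → Pred (Fin N) 0ℓ
  Successor A z = ∃ λ y → y ∈ A × y ⟶ z

  successor? : ∀ A → Decidable (Successor A)
  successor? A z = any? (λ y → y ∈? A ×-dec y ⟶? z)

  successors : Subset N → Subset N
  successors A = select (successor? A)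

  ReachableSet : Set
  ReachableSet = ∃ λ K → x₀ ∈ K × Reached K × Closed K

  closure : ∀ A → x₀ ∈ A → Reached A → ReachableSet
  closure = WF.All.wfRec ⊃-wellFounded 0ℓ _ step
    where
    step : ∀ A → WF.WfRec _⊃_ (λ B → x₀ ∈ B → Reached B → ReachableSet) A → x₀ ∈ A → Reached A → ReachableSet
    step A rec x₀∈A reached with successors A ⊆? A
    ... | yes closed = A , x₀∈A , reached , λ y∈A y⟶z → closed (∈-select⁺ (successor? A) (_ , y∈A , y⟶z))
    ... | no  open′ with ⊈⇒∃ open′
    ...   | z , z∈succ , z∉A = rec (p⊆p∪q (successors A) , z , x∈p∪q⁺ (inj₂ z∈succ) , z∉A)
                                   (x∈p∪q⁺ (inj₁ x₀∈A)) reached′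
      where
      reached′ : Reached (A ∪ successors A)
      reached′ {z} z∈ with x∈p∪q⁻ A (successors A) z∈
      ... | inj₁ z∈A    = reached z∈A
      ... | inj₂ z∈succ with ∈-select⁻ (successor? A) z∈succ
      ...   | y , y∈A , y⟶z = reached y∈A ◅◅ (y⟶z ◅ ε)

  private
    closure₀ : ReachableSet
    closure₀ = closure ⁅ x₀ ⁆ (x∈⁅x⁆ x₀) (λ z∈ → subst (Star _⟶_ x₀) (sym (x∈⁅y⁆⇒x≡y x₀ z∈)) ε)

  opaque
    reachable : Subset N
    reachable = proj₁ closure₀

    reachable-properties : x₀ ∈ reachable × Reached reachable × Closed reachable
    reachable-properties = proj₂ closure₀

  x₀∈reachable : x₀ ∈ reachable
  x₀∈reachable = proj₁ reachable-properties

  reachable⇒Star : Reached reachable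
  reachable⇒Star = proj₁ (proj₂ reachable-properties)

  reachable-closed : Closed reachable
  reachable-closed = proj₂ (proj₂ reachable-properties)

module _ {A : Set} {N : ℕ} (T : A → Subset N) {P : Pred A 0ℓ} (P? : Decidable P)
         (directed : ∀ {f g} → P f → P g → ∃ λ h → P h × T f ⊆ T h × T g ⊆ T h) where

  directed⇒greatest : ∀ {f} → P f → (xs : List A) → ∃ λ h → P h × All (λ g → P g → T g ⊆ T h) xs
  directed⇒greatest pf [] = _ , pf , []
  directed⇒greatest pf (g ∷ xs) with directed⇒greatest pf xs | P? g
  ... | h , ph , below | no ¬pg = h , ph , (λ pg → contradiction pg ¬pg) ∷ below
  ... | h , ph , below | yes pg with directed ph pg
  ...   | h′ , ph′ , h⊆h′ , g⊆h′ = h′ , ph′ , (λ _ → g⊆h′) ∷ All.map lift below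
    where
    lift : ∀ {g} → (P g → T g ⊆ T h) → P g → T g ⊆ T h′
    lift below-h pg′ = ⊆-trans (below-h pg′) h⊆h′

module _ {N : ℕ} {R : TransitMap N} where

  u∈R[u,v] : IsTransitFunction R → ∀ u v → u ∈ R u v
  u∈R[u,v] = proj₁

  v∈R[u,v] : IsTransitFunction R → ∀ u v → v ∈ R u v
  v∈R[u,v] (u∈R , R-sym , _) u v = subst (v ∈_) (R-sym v u) (u∈R v u)

  𝒞-convex : IsMonotone R → ∀ {C p q} → 𝒞 R C → p ∈ C → q ∈ C → R p q ⊆ C
  𝒞-convex mono (a , b , refl) = mono a b _ _

  module WeakBetaCycleIn𝒞 (mono : IsMonotone R) {k} {C : Fin (3 + k) → Subset N} {x : Fin (3 + k) → Fin N}
    (C∈𝒞 : ∀ i → 𝒞 R (C i)) (x∈C : ∀ i → x i ∈ C i × x i ∈ C (next i))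
    (x∉C : ∀ i l → l ≢ i → l ≢ next i → x i ∉ C l) where

    R⊆C : ∀ i → R (x i) (x (next i)) ⊆ C (next i)
    R⊆C i = 𝒞-convex mono (C∈𝒞 (next i)) (proj₂ (x∈C i)) (proj₁ (x∈C (next i)))

    x∉R : ∀ i j → j ≢ i → j ≢ prev i → x i ∉ R (x j) (x (next j))
    x∉R i j j≢i j≢prev-i x∈R =
      x∉C i (next j) (λ eq → j≢prev-i (trans (sym (prev-next j)) (cong prev eq))) (j≢i ∘ next-injective) (R⊆C j x∈R)

    prev∉R : ∀ j → x (prev j) ∉ R (x j) (x (next j))
    prev∉R j = x∉R (prev j) j
      (λ eq → next≢id j (trans (cong next eq) (next-prev j)))
      (λ eq → next∘next≢id j (trans (cong (next ∘ next) eq) (trans (cong next (next-prev (prev j))) (next-prev j))))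

    next∉R : ∀ j → x (next j) ∉ R (x (prev j)) (x j)
    next∉R j = subst (λ i → x (next j) ∉ R (x (prev j)) (x i)) (next-prev j) (x∉R (next j) (prev j)
      (λ eq → next∘next≢id j (sym (trans (sym (next-prev j)) (cong next eq))))
      (λ eq → next≢id j (sym (trans (sym (next-prev j)) (trans (cong next eq) (cong next (prev-next j)))))))

    x-distinct : ∀ {i l} → i ≢ l → x i ≢ x l
    x-distinct {i} {l} i≢l eq with i Fin.≟ next l
    ... | no  i≢next-l = x∉C l i i≢l i≢next-l (subst (_∈ C i) eq (proj₁ (x∈C i)))
    ... | yes refl     = x∉C l (next (next l)) (next∘next≢id l) (next≢id (next l))
                             (subst (_∈ C (next (next l))) eq (proj₂ (x∈C (next l))))

    ¬tb' : ¬ TB' R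
    ¬tb' tb' with tb' k x (λ j → prev∉R j , next∉R j)
    ... | j , i , i≢j , i≢prev-j , xj∈R = x∉R j i i≢j i≢prev-j xj∈R

    inVertices? : Decidable (λ z → ∃ λ i → x i ≡ z)
    inVertices? z = any? (λ i → x i Fin.≟ z)

    vertices : Subset N
    vertices = select inVertices?

    x∈vertices : ∀ i → x i ∈ vertices
    x∈vertices i = ∈-select⁺ inVertices? (i , refl)

    3≤∣vertices∣ : 3 ≤ ∣ vertices ∣
    3≤∣vertices∣ = 3≤∣p∣ (x∈vertices zero) (x∈vertices (suc zero)) (x∈vertices (suc (suc zero)))
                         (x-distinct (λ ())) (x-distinct (λ ())) (x-distinct (λ ()))

    ¬tb : IsTransitFunction R → ¬ TB R
    ¬tb isTransit@(_ , R-sym , _) tb with tb vertices 3≤∣vertices∣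
    ... | y , y∈vertices , comparable with ∈-select⁻ inVertices? y∈vertices
    ... | j , refl with comparable (x (prev j)) (x (next j)) (x∈vertices (prev j)) (x∈vertices (next j))
    ...   | inj₁ ⊆next = prev∉R j (⊆next (v∈R[u,v] isTransit _ _))
    ...   | inj₂ ⊆prev = next∉R j (subst (x (next j) ∈_) (R-sym _ _) (⊆prev (v∈R[u,v] isTransit _ _)))

  tb'⇒totallyBalanced : IsMonotone R → TB' R → TotallyBalanced (𝒞 R)
  tb'⇒totallyBalanced mono tb' (_ , _ , _ , C∈𝒞 , x∈C , x∉C) = WeakBetaCycleIn𝒞.¬tb' mono C∈𝒞 x∈C x∉C tb'

  tb⇒totallyBalanced : IsTransitFunction R → IsMonotone R → TB R → TotallyBalanced (𝒞 R)
  tb⇒totallyBalanced isTransit mono tb (_ , _ , _ , C∈𝒞 , x∈C , x∉C) =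
    WeakBetaCycleIn𝒞.¬tb mono C∈𝒞 x∈C x∉C isTransit tb

  totallyBalanced⇒chord : IsTransitFunction R → TotallyBalanced (𝒞 R) → ∀ k (v : Fin (3 + k) → Fin N) →
    ∃[ j ] ∃[ i ] (i ≢ j × i ≢ prev j × v j ∈ R (v i) (v (next i)))
  totallyBalanced⇒chord isTransit acyclic k v
    with any? (λ j → any? (λ i → ¬? (i Fin.≟ j) ×-dec ¬? (i Fin.≟ prev j) ×-dec (v j ∈? R (v i) (v (next i)))))
  ... | yes chord = chord
  ... | no ∄chord = ⊥-elim (acyclic (k , C , v ∘ next , (λ i → v i , v (next i) , refl) , x∈C , x∉C))
    where
    C : Fin (3 + k) → Subset N
    C i = R (v i) (v (next i))
    x∈C : ∀ i → v (next i) ∈ C i × v (next i) ∈ C (next i)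
    x∈C i = v∈R[u,v] isTransit _ _ , u∈R[u,v] isTransit _ _
    x∉C : ∀ i l → l ≢ i → l ≢ next i → v (next i) ∉ C l
    x∉C i l l≢i l≢next-i x∈C = ∄chord (next i , l , l≢next-i , (λ eq → l≢i (trans eq (prev-next i))) , x∈C)

module _ {N : ℕ} (R : TransitMap N) where

  Edge : Set
  Edge = Fin N × Fin N

  ⟦_⟧ : Edge → Subset N
  ⟦ a , b ⟧ = R a b

  ⟦⟧∈𝒞 : ∀ f → 𝒞 R ⟦ f ⟧
  ⟦⟧∈𝒞 (a , b) = a , b , refl

  anyEdge? : {P : Pred Edge 0ℓ} → Decidable P → Dec (∃ P)
  anyEdge? P? with any? (λ a → any? (λ b → P? (a , b)))
  ... | yes (a , b , p) = yes ((a , b) , p)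
  ... | no  ∄p          = no (λ { ((a , b) , p) → ∄p (a , b , p) })

  allEdges : List Edge
  allEdges = cartesianProduct (allFin N) (allFin N)

  ∈-allEdges : ∀ f → f ∈ₗ allEdges
  ∈-allEdges (a , b) = ∈-cartesianProduct⁺ (∈-allFin a) (∈-allFin b)

  trace : Subset N → Edge → Subset N
  trace U f = U ∩ ⟦ f ⟧

  ProperFor : Subset N → Edge → Set
  ProperFor U f = ∃ λ u → u ∈ U × u ∉ ⟦ f ⟧

  properFor? : ∀ U f → Dec (ProperFor U f)
  properFor? U f = any? (λ u → u ∈? U ×-dec ¬? (u ∈? ⟦ f ⟧))

  ¬properFor⇒⊆ : ∀ {U f} → ¬ ProperFor U f → U ⊆ ⟦ f ⟧
  ¬properFor⇒⊆ {U} {f} improper {z} z∈U = decidable-stable (z ∈? ⟦ f ⟧) (λ z∉f → improper (z , z∈U , z∉f))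

  IsNestPoint : Subset N → Fin N → Set
  IsNestPoint U y = ∀ f g → y ∈ ⟦ f ⟧ → y ∈ ⟦ g ⟧ → trace U f ⊆ trace U g ⊎ trace U g ⊆ trace U f

  NestPointOutside : Subset N → Edge → Set
  NestPointOutside U e = ∃ λ y → y ∈ U × y ∉ ⟦ e ⟧ × IsNestPoint U y

  nestPointOutside-anti : ∀ {U e f} → trace U e ⊆ trace U f → NestPointOutside U f → NestPointOutside U e
  nestPointOutside-anti {U} e⊆f (y , y∈U , y∉f , nest) =
    y , y∈U , (λ y∈e → y∉f (proj₂ (x∈p∩q⁻ U _ (e⊆f (x∈p∩q⁺ (y∈U , y∈e)))))) , nest

  -- Closed up by e, a pseudo-cycle without chords is a weak β-cycle of length m + 2.
  record PseudoCycle (e : Edge) (m : ℕ) : Set where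
    field
      F    : ℕ → Edge
      X    : ℕ → Fin N
      w v  : Fin N
      w∈e  : w ∈ ⟦ e ⟧
      w∈F₀ : w ∈ ⟦ F 0 ⟧
      w∉F  : ∀ {l} → 0 < l → l ≤ m → w ∉ ⟦ F l ⟧
      v∈e  : v ∈ ⟦ e ⟧
      v∈Fₘ : v ∈ ⟦ F m ⟧
      v∉F  : ∀ {l} → l < m → v ∉ ⟦ F l ⟧
      X∈F  : ∀ {j} → j < m → X j ∈ ⟦ F j ⟧ × X j ∈ ⟦ F (suc j) ⟧
      X∉e  : ∀ {j} → j < m → X j ∉ ⟦ e ⟧

    Chord : Set
    Chord = ∃ λ j → j < m × ∃ λ l → l < suc m × l ≢ j × l ≢ suc j × X j ∈ ⟦ F l ⟧

    chord? : Dec Chord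
    chord? = anyUpTo? (λ j → anyUpTo? (λ l → ¬? (l ≟ j) ×-dec ¬? (l ≟ suc j) ×-dec (X j ∈? ⟦ F l ⟧)) (suc m)) m

  module ChordlessPseudoCycle {e : Edge} {k : ℕ} (P : PseudoCycle e (suc k)) (chordless : ¬ PseudoCycle.Chord P) where
    open PseudoCycle P

    setAt : ℕ → Subset N
    setAt zero    = ⟦ e ⟧
    setAt (suc l) = ⟦ F l ⟧

    cycleSet : Fin (3 + k) → Subset N
    cycleSet i = setAt (toℕ i)

    cycleVertex : Fin (3 + k) → Fin N
    cycleVertex zero = w
    cycleVertex (suc s) with view s
    ... | ‵fromℕ     = v
    ... | ‵inject₁ t = X (toℕ t)

    cycleVertex∈ : ∀ i → cycleVertex i ∈ cycleSet i × cycleVertex i ∈ cycleSet (next i)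
    cycleVertex∈ zero = w∈e , subst (λ i → w ∈ cycleSet i) (sym (next-inject₁ zero)) w∈F₀
    cycleVertex∈ (suc s) with view s
    ... | ‵fromℕ     = subst (λ l → v ∈ ⟦ F l ⟧) (sym (toℕ-fromℕ (suc k))) v∈Fₘ
                     , subst (λ i → v ∈ cycleSet i) (sym (next-fromℕ (2 + k))) v∈e
    ... | ‵inject₁ t = subst (λ l → X (toℕ t) ∈ ⟦ F l ⟧) (sym (toℕ-inject₁ t)) (proj₁ (X∈F (toℕ<n t)))
                     , subst (λ i → X (toℕ t) ∈ cycleSet i) (sym (next-inject₁ (suc t))) (proj₂ (X∈F (toℕ<n t)))

    cycleVertex∉ : ∀ i l → l ≢ i → l ≢ next i → cycleVertex i ∉ cycleSet l
    cycleVertex∉ zero zero l≢i _ = contradiction refl l≢i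
    cycleVertex∉ zero (suc s) _ l≢next = w∉F (n≢0⇒n>0 s≢0) (≤-pred (toℕ<n s))
      where
      s≢0 : toℕ s ≢ 0
      s≢0 eq = l≢next (trans (cong suc (toℕ-injective eq)) (sym (next-inject₁ zero)))
    cycleVertex∉ (suc s) l l≢i l≢next with view s
    cycleVertex∉ (suc s) zero l≢i l≢next | ‵fromℕ = contradiction (sym (next-fromℕ (2 + k))) l≢next
    cycleVertex∉ (suc s) (suc s′) l≢i l≢next | ‵fromℕ = v∉F (≤∧≢⇒< (≤-pred (toℕ<n s′)) s′≢last)
      where
      s′≢last : toℕ s′ ≢ suc k
      s′≢last eq = l≢i (cong suc (toℕ-injective (trans eq (sym (toℕ-fromℕ (suc k))))))
    cycleVertex∉ (suc s) zero l≢i l≢next | ‵inject₁ t = X∉e (toℕ<n t)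
    cycleVertex∉ (suc s) (suc s′) l≢i l≢next | ‵inject₁ t =
      λ Xₜ∈F → chordless (toℕ t , toℕ<n t , toℕ s′ , toℕ<n s′ , s′≢t , s′≢suc-t , Xₜ∈F)
      where
      s′≢t : toℕ s′ ≢ toℕ t
      s′≢t eq = l≢i (cong suc (toℕ-injective (trans eq (sym (toℕ-inject₁ t)))))
      s′≢suc-t : toℕ s′ ≢ suc (toℕ t)
      s′≢suc-t eq = l≢next (trans (cong suc (toℕ-injective {j = suc t} eq)) (sym (next-inject₁ (suc t))))

    setAt∈𝒞 : ∀ l → 𝒞 R (setAt l)
    setAt∈𝒞 zero    = ⟦⟧∈𝒞 e
    setAt∈𝒞 (suc l) = ⟦⟧∈𝒞 (F l)

    weakBetaCycle : WeakBetaCycle (𝒞 R)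
    weakBetaCycle = k , cycleSet , cycleVertex , setAt∈𝒞 ∘ toℕ , cycleVertex∈ , cycleVertex∉

  module Shortcut {e : Edge} {M : ℕ} (P : PseudoCycle e M) {m d : ℕ} (m+d≡M : m + d ≡ M)
                  {a : ℕ} {b : Fin N} (a<m : a < m) (b∈Fₐ : b ∈ ⟦ PseudoCycle.F P a ⟧)
                  (b∈F : b ∈ ⟦ PseudoCycle.F P (suc a + d) ⟧) (b∉e : b ∉ ⟦ e ⟧) where
    open PseudoCycle P

    skip : ℕ → ℕ
    skip i with i ≤? a
    ... | yes _ = i
    ... | no  _ = i + d

    skip-≤ : ∀ {i} → i ≤ a → skip i ≡ i
    skip-≤ {i} i≤a with i ≤? a
    ... | yes _   = refl
    ... | no  i≰a = contradiction i≤a i≰a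

    skip-> : ∀ {i} → a < i → skip i ≡ i + d
    skip-> {i} a<i with i ≤? a
    ... | yes i≤a = contradiction i≤a (<⇒≱ a<i)
    ... | no  _   = refl

    ≤-skip : ∀ i → i ≤ skip i
    ≤-skip i with i ≤? a
    ... | yes _ = ≤-refl
    ... | no  _ = m≤m+n i d

    skip-≤-+ : ∀ i → skip i ≤ i + d
    skip-≤-+ i with i ≤? a
    ... | yes _ = m≤m+n i d
    ... | no  _ = ≤-refl

    skip-suc : ∀ {j} → j ≢ a → skip (suc j) ≡ suc (skip j)
    skip-suc {j} j≢a with <-cmp j a
    ... | tri< j<a _ _ = trans (skip-≤ j<a) (cong suc (sym (skip-≤ (<⇒≤ j<a))))
    ... | tri≈ _ j≡a _ = contradiction j≡a j≢a
    ... | tri> _ _ a<j = trans (skip-> (m<n⇒m<1+n a<j)) (cong suc (sym (skip-> a<j)))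

    skip-<M : ∀ {l} → l < m → skip l < M
    skip-<M {l} l<m = ≤-<-trans (skip-≤-+ l) (subst (l + d <_) m+d≡M (+-monoˡ-< d l<m))

    X′ : ℕ → Fin N
    X′ j with j ≟ a
    ... | yes _ = b
    ... | no  _ = X (skip j)

    X′∈F : ∀ {j} → j < m → X′ j ∈ ⟦ F (skip j) ⟧ × X′ j ∈ ⟦ F (skip (suc j)) ⟧
    X′∈F {j} j<m with j ≟ a
    ... | yes refl = subst (λ i → b ∈ ⟦ F i ⟧) (sym (skip-≤ ≤-refl)) b∈Fₐ
                   , subst (λ i → b ∈ ⟦ F i ⟧) (sym (skip-> ≤-refl)) b∈F
    ... | no  j≢a  = proj₁ (X∈F (skip-<M j<m))
                   , subst (λ i → X (skip j) ∈ ⟦ F i ⟧) (sym (skip-suc j≢a)) (proj₂ (X∈F (skip-<M j<m)))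

    X′∉e : ∀ {j} → j < m → X′ j ∉ ⟦ e ⟧
    X′∉e {j} j<m with j ≟ a
    ... | yes _ = b∉e
    ... | no  _ = X∉e (skip-<M j<m)

    shortened : PseudoCycle e m
    shortened = record
      { F    = F ∘ skip
      ; X    = X′
      ; w    = w
      ; v    = v
      ; w∈e  = w∈e
      ; w∈F₀ = subst (λ i → w ∈ ⟦ F i ⟧) (sym (skip-≤ z≤n)) w∈F₀
      ; w∉F  = λ {l} 0<l l≤m → w∉F (≤-trans 0<l (≤-skip l))
                 (≤-trans (skip-≤-+ l) (subst (l + d ≤_) m+d≡M (+-monoˡ-≤ d l≤m)))
      ; v∈e  = v∈e
      ; v∈Fₘ = subst (λ i → v ∈ ⟦ F i ⟧) (sym (trans (skip-> a<m) m+d≡M)) v∈Fₘ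
      ; v∉F  = v∉F ∘ skip-<M
      ; X∈F  = X′∈F
      ; X∉e  = X′∉e
      }

  shortcut : ∀ {e M} (P : PseudoCycle e M) {a c b} → suc a < c → c ≤ M →
           b ∈ ⟦ PseudoCycle.F P a ⟧ → b ∈ ⟦ PseudoCycle.F P c ⟧ → b ∉ ⟦ e ⟧ →
           ∃ λ m → m < M × 0 < m × PseudoCycle e m
  shortcut {M = M} P {a} {c} 1+a<c c≤M b∈Fₐ b∈F-c b∉e =
    M ∸ d , ∸-monoʳ-< (m<n⇒0<n∸m 1+a<c) d≤M , ≤-trans (s≤s z≤n) a<m ,
    Shortcut.shortened P (m∸n+n≡m d≤M) a<m b∈Fₐ (subst (λ i → _ ∈ ⟦ PseudoCycle.F P i ⟧) c≡1+a+d b∈F-c) b∉e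
    where
    d : ℕ
    d = c ∸ suc a
    c≡1+a+d : c ≡ suc a + d
    c≡1+a+d = sym (m+[n∸m]≡n (<⇒≤ 1+a<c))
    d≤M : d ≤ M
    d≤M = ≤-trans (m∸n≤m c (suc a)) c≤M
    a<m : a < M ∸ d
    a<m = m+n≤o⇒m≤o∸n (suc a) (subst (_≤ M) c≡1+a+d c≤M)

  chord⇒shorter : ∀ {e M} (P : PseudoCycle e M) → PseudoCycle.Chord P → ∃ λ m → m < M × 0 < m × PseudoCycle e m
  chord⇒shorter P (j , j<M , l , l<1+M , l≢j , l≢1+j , Xⱼ∈Fₗ) with <-cmp l j
  ... | tri< l<j _ _ = shortcut P (s≤s l<j) j<M Xⱼ∈Fₗ (proj₂ (PseudoCycle.X∈F P j<M)) (PseudoCycle.X∉e P j<M)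
  ... | tri≈ _ l≡j _ = contradiction l≡j l≢j
  ... | tri> _ _ j<l = shortcut P (≤∧≢⇒< j<l (l≢1+j ∘ sym)) (≤-pred l<1+M) (proj₁ (PseudoCycle.X∈F P j<M)) Xⱼ∈Fₗ
                                (PseudoCycle.X∉e P j<M)

  module _ (acyclic : TotallyBalanced (𝒞 R)) where

    noPseudoCycle : ∀ {e} m → 0 < m → ¬ PseudoCycle e m
    noPseudoCycle = <-rec _ λ where
      (suc k) shorterImpossible _ P → case PseudoCycle.chord? P of λ where
        (no  chordless) → acyclic (ChordlessPseudoCycle.weakBetaCycle P chordless)
        (yes chord)     → let m , m<M , 0<m , P′ = chord⇒shorter P chord in shorterImpossible m<M 0<m P′

    module MaximalCase (U : Subset N) (e : Edge) {k₀ : Fin N} (k₀∈U : k₀ ∈ U) (k₀∉e : k₀ ∉ ⟦ e ⟧)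
      (maximal : ∀ f → ProperFor U f → ¬ trace U e ⊂ trace U f)
      (ih : ∀ {U′} → U′ ⊂ U → ∀ e′ → ProperFor U′ e′ → NestPointOutside U′ e′) where

      Outside : Pred (Fin N) 0ℓ
      Outside z = z ∈ U × z ∉ ⟦ e ⟧

      _⟶_ : Rel (Fin N) 0ℓ
      y ⟶ z = Outside z × ∃ λ h → ProperFor U h × y ∈ ⟦ h ⟧ × z ∈ ⟦ h ⟧

      _⟶?_ : Decidable₂ _⟶_
      y ⟶? z = (z ∈? U ×-dec ¬? (z ∈? ⟦ e ⟧)) ×-dec anyEdge? (λ h → properFor? U h ×-dec y ∈? ⟦ h ⟧ ×-dec z ∈? ⟦ h ⟧)

      open Reachability _⟶_ _⟶?_ k₀ using ()
        renaming (reachable to K; x₀∈reachable to k₀∈K; reachable⇒Star to K⇒Star; reachable-closed to K-closed)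

      Star⇒Outside : ∀ {a z} → Star _⟶_ a z → Outside a → Outside z
      Star⇒Outside ε              a-outside = a-outside
      Star⇒Outside (step ◅ steps) _         = Star⇒Outside steps (proj₁ step)

      K⊆Outside : ∀ {z} → z ∈ K → Outside z
      K⊆Outside z∈K = Star⇒Outside (K⇒Star z∈K) (k₀∈U , k₀∉e)

      Touching : Pred Edge 0ℓ
      Touching f = ProperFor U f × ∃ λ y → y ∈ K × y ∈ ⟦ f ⟧

      touching? : Decidable Touching
      touching? f = properFor? U f ×-dec any? (λ y → y ∈? K ×-dec y ∈? ⟦ f ⟧)

      record Chain (m : ℕ) : Set where
        field
          F          : ℕ → Edge
          X          : ℕ → Fin N
          F-touching : ∀ {l} → l ≤ m → Touching (F l)
          X∈F        : ∀ {j} → j < m → X j ∈ ⟦ F j ⟧ × X j ∈ ⟦ F (suc j) ⟧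
          X∈K        : ∀ {j} → j < m → X j ∈ K
      open Chain

      [_] : ∀ {f} → Touching f → Chain 0
      [_] {f} f-touching = record
        { F = λ _ → f ; X = λ _ → k₀ ; F-touching = λ _ → f-touching ; X∈F = λ () ; X∈K = λ () }

      cons : ∀ {h x m} → Touching h → x ∈ K → x ∈ ⟦ h ⟧ → (P : Chain m) → x ∈ ⟦ F P 0 ⟧ → Chain (suc m)
      cons {h} {x} h-touching x∈K x∈h P x∈F₀ = record
        { F          = λ { zero → h ; (suc l) → F P l }
        ; X          = λ { zero → x ; (suc j) → X P j }
        ; F-touching = λ { {zero} _ → h-touching ; {suc l} (s≤s l≤m) → F-touching P l≤m }
        ; X∈F        = λ { {zero} _ → x∈h , x∈F₀ ; {suc j} (s≤s j<m) → X∈F P j<m }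
        ; X∈K        = λ { {zero} _ → x∈K ; {suc j} (s≤s j<m) → X∈K P j<m }
        }

      tail : ∀ {m} → Chain (suc m) → Chain m
      tail P = record
        { F          = F P ∘ suc
        ; X          = X P ∘ suc
        ; F-touching = λ l≤m → F-touching P (s≤s l≤m)
        ; X∈F        = λ j<m → X∈F P (s≤s j<m)
        ; X∈K        = λ j<m → X∈K P (s≤s j<m)
        }

      ChainFrom : Fin N → Edge → Set
      ChainFrom z g = ∃ λ m → Σ (Chain m) λ P → z ∈ ⟦ F P 0 ⟧ × F P m ≡ g

      prependWalk : ∀ {a z g} → Star _⟶_ a z → a ∈ K → ChainFrom z g → ChainFrom a g
      prependWalk ε _ chain = chain
      prependWalk (step@(_ , h , h-proper , a∈h , y∈h) ◅ steps) a∈K chain with prependWalk steps (K-closed a∈K step) chain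
      ... | m , P , y∈F₀ , end = suc m , cons (h-proper , _ , a∈K , a∈h) (K-closed a∈K step) y∈h P y∈F₀ , a∈h , end

      rerootAlongWalk : ∀ {a z g} → Star _⟶_ a z → a ∈ K → ChainFrom a g → ChainFrom z g
      rerootAlongWalk ε _ chain = chain
      rerootAlongWalk (step@(_ , h , h-proper , a∈h , y∈h) ◅ steps) a∈K (m , P , a∈F₀ , end) =
        rerootAlongWalk steps (K-closed a∈K step) (suc m , cons (h-proper , _ , a∈K , a∈h) a∈K a∈h P a∈F₀ , y∈h , end)

      chainBetween : ∀ {f g} → Touching f → Touching g → ∃ λ m → Σ (Chain m) λ P → F P 0 ≡ f × F P m ≡ g
      chainBetween f-touching@(_ , y , y∈K , y∈f) g-touching@(_ , z , z∈K , z∈g)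
        with rerootAlongWalk (K⇒Star y∈K) k₀∈K (prependWalk (K⇒Star z∈K) k₀∈K (0 , [ g-touching ] , z∈g , refl))
      ... | m , P , y∈F₀ , end = suc m , cons f-touching y∈K y∈f P y∈F₀ , refl , end

      S : Subset N
      S = U ∩ ⟦ e ⟧

      IsDominator : ∀ {m} → Chain m → ℕ → Set
      IsDominator {m} P p = ∀ {l} → l ≤ m → trace S (F P l) ⊆ trace S (F P p)

      incomparable⇒pseudoCycle : ∀ {m} (P : Chain (suc m)) {p} → p ≤ m → IsDominator (tail P) p →
        ¬ trace S (F P 0) ⊆ trace S (F P (suc p)) → ¬ trace S (F P (suc p)) ⊆ trace S (F P 0) →
        ∃ λ n → 0 < n × PseudoCycle e n
      incomparable⇒pseudoCycle {m} P {p} p≤m dominates 0⊈p p⊈0 with ⊈⇒∃ 0⊈p | ⊈⇒∃ p⊈0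
      ... | w , w∈T₀ , w∉Tₚ | v , v∈Tₚ , v∉T₀ with x∈p∩q⁻ S _ w∈T₀ | x∈p∩q⁻ S _ v∈Tₚ
      ... | w∈S , w∈F₀ | v∈S , v∈Fₚ with ∃-least (λ l → v ∈? ⟦ F P l ⟧) v∈Fₚ
      ... | n , n≤1+p , v∈Fₙ , v∉F = n , n≢0⇒n>0 n≢0 , record
        { F    = F P
        ; X    = X P
        ; w    = w
        ; v    = v
        ; w∈e  = proj₂ (x∈p∩q⁻ U _ w∈S)
        ; w∈F₀ = w∈F₀
        ; w∉F  = λ { {suc l} _ 1+l≤n w∈Fₗ →
                     w∉Tₚ (dominates (≤-pred (≤-trans 1+l≤n n≤1+m)) (x∈p∩q⁺ (w∈S , w∈Fₗ))) }
        ; v∈e  = proj₂ (x∈p∩q⁻ U _ v∈S)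
        ; v∈Fₘ = v∈Fₙ
        ; v∉F  = v∉F
        ; X∈F  = λ j<n → X∈F P (≤-trans j<n n≤1+m)
        ; X∉e  = λ j<n → proj₂ (K⊆Outside (X∈K P (≤-trans j<n n≤1+m)))
        }
        where
        n≤1+m : n ≤ suc m
        n≤1+m = ≤-trans n≤1+p (s≤s p≤m)
        n≢0 : n ≢ 0
        n≢0 n≡0 = v∉T₀ (x∈p∩q⁺ (v∈S , subst (λ i → v ∈ ⟦ F P i ⟧) n≡0 v∈Fₙ))

      chain-dominator : ∀ m (P : Chain m) → ∃ λ p → p ≤ m × IsDominator P p
      chain-dominator zero    P = 0 , z≤n , λ { z≤n z∈ → z∈ }
      chain-dominator (suc m) P with chain-dominator m (tail P)
      ... | p , p≤m , dominates
        with trace S (F P 0) ⊆? trace S (F P (suc p)) | trace S (F P (suc p)) ⊆? trace S (F P 0)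
      ... | yes 0⊆p | _        = suc p , s≤s p≤m , λ { {zero} _ → 0⊆p ; {suc l} (s≤s l≤m) → dominates l≤m }
      ... | no  _   | yes p⊆0  = 0 , z≤n , λ { {zero} _ z∈ → z∈ ; {suc l} (s≤s l≤m) z∈ → p⊆0 (dominates l≤m z∈) }
      ... | no  0⊈p | no  p⊈0 with incomparable⇒pseudoCycle P p≤m dominates 0⊈p p⊈0
      ...   | n , 0<n , C = ⊥-elim (noPseudoCycle n 0<n C)

      touching-directed : ∀ {f g} → Touching f → Touching g →
                          ∃ λ h → Touching h × trace S f ⊆ trace S h × trace S g ⊆ trace S h
      touching-directed f-touching g-touching with chainBetween f-touching g-touching
      ... | m , P , refl , refl with chain-dominator m P
      ... | p , p≤m , dominates = F P p , F-touching P p≤m , dominates z≤n , dominates ≤-refl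

      greatestTouching : ∀ {f} → Touching f → ∃ λ h → Touching h × ∀ g → Touching g → trace S g ⊆ trace S h
      greatestTouching f-touching with directed⇒greatest (trace S) touching? touching-directed f-touching allEdges
      ... | h , h-touching , below = h , h-touching , λ g → All.lookup below (∈-allEdges g)

      Relevant : Pred (Fin N) 0ℓ
      Relevant z = z ∈ K ⊎ (z ∈ S × ∃ λ g → Touching g × z ∈ ⟦ g ⟧)

      relevant? : Decidable Relevant
      relevant? z = z ∈? K ⊎-dec (z ∈? S ×-dec anyEdge? (λ g → touching? g ×-dec z ∈? ⟦ g ⟧))

      opaque
        U′ : Subset N
        U′ = select relevant?

        ∈U′⁺ : ∀ {z} → Relevant z → z ∈ U′
        ∈U′⁺ = ∈-select⁺ relevant?

        ∈U′⁻ : ∀ {z} → z ∈ U′ → Relevant z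
        ∈U′⁻ = ∈-select⁻ relevant?

      U′⊆U : U′ ⊆ U
      U′⊆U z∈U′ with ∈U′⁻ z∈U′
      ... | inj₁ z∈K       = proj₁ (K⊆Outside z∈K)
      ... | inj₂ (z∈S , _) = proj₁ (x∈p∩q⁻ U _ z∈S)

      trace⊆U′ : ∀ {f y} → ProperFor U f → y ∈ K → y ∈ ⟦ f ⟧ → trace U f ⊆ U′
      trace⊆U′ {f} {y} f-proper y∈K y∈f {z} z∈trace = ∈U′⁺ (relevant (z ∈? ⟦ e ⟧))
        where
        z∈U : z ∈ U
        z∈U = proj₁ (x∈p∩q⁻ U _ z∈trace)
        z∈f : z ∈ ⟦ f ⟧
        z∈f = proj₂ (x∈p∩q⁻ U _ z∈trace)
        relevant : Dec (z ∈ ⟦ e ⟧) → Relevant z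
        relevant (yes z∈e) = inj₂ (x∈p∩q⁺ (z∈U , z∈e) , f , (f-proper , y , y∈K , y∈f) , z∈f)
        relevant (no  z∉e) = inj₁ (K-closed y∈K ((z∈U , z∉e) , f , f-proper , y∈f , z∈f))

      U′∖e⊆K : ∀ {y} → y ∈ U′ → y ∉ ⟦ e ⟧ → y ∈ K
      U′∖e⊆K y∈U′ y∉e with ∈U′⁻ y∈U′
      ... | inj₁ y∈K       = y∈K
      ... | inj₂ (y∈S , _) = contradiction (proj₂ (x∈p∩q⁻ U _ y∈S)) y∉e

      nestPoint-lift : ∀ {y} → y ∈ K → IsNestPoint U′ y → IsNestPoint U y
      nestPoint-lift {y} y∈K y-nest f g y∈f y∈g = compare (properFor? U f) (properFor? U g)
        where
        compare : Dec (ProperFor U f) → Dec (ProperFor U g) → trace U f ⊆ trace U g ⊎ trace U g ⊆ trace U f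
        compare (no  f-improper) _                = inj₂ (⊆⇒∩⊆∩ (¬properFor⇒⊆ f-improper))
        compare (yes _)          (no  g-improper) = inj₁ (⊆⇒∩⊆∩ (¬properFor⇒⊆ g-improper))
        compare (yes f-proper)   (yes g-proper)   =
          Sum.map (∩⊆∩-restrict (trace⊆U′ f-proper y∈K y∈f)) (∩⊆∩-restrict (trace⊆U′ g-proper y∈K y∈g))
                  (y-nest f g y∈f y∈g)

      nestPoint-U′⊂U : U′ ⊂ U → NestPointOutside U e
      nestPoint-U′⊂U U′⊂U with ih U′⊂U e (k₀ , ∈U′⁺ (inj₁ k₀∈K) , k₀∉e)
      ... | y , y∈U′ , y∉e , y-nest = y , U′⊆U y∈U′ , y∉e , nestPoint-lift (U′∖e⊆K y∈U′ y∉e) y-nest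

      nestPoint-U⊆U′ : U ⊆ U′ → NestPointOutside U e
      nestPoint-U⊆U′ U⊆U′ with anyEdge? touching?
      ... | no ∄touching = k₀ , k₀∈U , k₀∉e , λ f g _ k₀∈g → inj₁ (⊆⇒∩⊆∩ (k₀∈⇒covers k₀∈g))
        where
        k₀∈⇒covers : ∀ {f} → k₀ ∈ ⟦ f ⟧ → U ⊆ ⟦ f ⟧
        k₀∈⇒covers {f} k₀∈f = ¬properFor⇒⊆ (λ f-proper → ∄touching (f , f-proper , k₀ , k₀∈K , k₀∈f))
      ... | yes (f , f-touching) with greatestTouching f-touching
      ...   | h , (h-proper , y , y∈K , y∈h) , greatest =
        ⊥-elim (maximal h h-proper (e⊆h , y , x∈p∩q⁺ (proj₁ (K⊆Outside y∈K) , y∈h) , y∉trace-e))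
        where
        y∉trace-e : y ∉ trace U e
        y∉trace-e = proj₂ (K⊆Outside y∈K) ∘ proj₂ ∘ x∈p∩q⁻ U _
        e⊆h : trace U e ⊆ trace U h
        e⊆h z∈ with x∈p∩q⁻ U _ z∈
        ... | z∈U , z∈e with ∈U′⁻ (U⊆U′ z∈U)
        ...   | inj₁ z∈K = contradiction z∈e (proj₂ (K⊆Outside z∈K))
        ...   | inj₂ (z∈S , g , g-touching , z∈g) =
          x∈p∩q⁺ (z∈U , proj₂ (x∈p∩q⁻ S _ (greatest g g-touching (x∈p∩q⁺ (z∈S , z∈g)))))

      nestPoint : NestPointOutside U e
      nestPoint with U ⊆? U′
      ... | yes U⊆U′ = nestPoint-U⊆U′ U⊆U′
      ... | no  U⊈U′ = nestPoint-U′⊂U (U′⊆U , ⊈⇒∃ U⊈U′)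

    nestPointOutside : ∀ U e → ProperFor U e → NestPointOutside U e
    nestPointOutside = WF.All.wfRec ⊂-wellFounded 0ℓ _ λ U ih →
      WF.All.wfRec (On.wellFounded (trace U) ⊃-wellFounded) 0ℓ _ λ where
        e larger (k₀ , k₀∈U , k₀∉e) → case anyEdge? (λ f → properFor? U f ×-dec trace U e ⊂? trace U f) of λ where
          (yes (f , f-proper , e⊂f)) → nestPointOutside-anti (proj₁ e⊂f) (larger e⊂f f-proper)
          (no ∄larger) → MaximalCase.nestPoint U e k₀∈U k₀∉e (λ f f-proper e⊂f → ∄larger (f , f-proper , e⊂f)) ih

hc⇒tb : ∀ {N} {R : TransitMap N} → HC R → TB R
hc⇒tb hc W 3≤∣W∣ with hc W 3≤∣W∣
... | x , _ , x∈W , _ , _ , x-comparable , _ = x , x∈W , x-comparable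

module _ {N : ℕ} {R : TransitMap N} (isTransit : IsTransitFunction R) (mono : IsMonotone R) where

  nestPoint⇒comparable : ∀ {W y} → IsNestPoint R W y → Comparable R W y
  nestPoint⇒comparable {W} {y} nest u v u∈W v∈W =
    Sum.map (⊆R[y,-] u∈W) (⊆R[y,-] v∈W) (nest (y , u) (y , v) (u∈R[u,v] isTransit y u) (u∈R[u,v] isTransit y v))
    where
    ⊆R[y,-] : ∀ {u v} → u ∈ W → trace R W (y , u) ⊆ trace R W (y , v) → R y u ⊆ R y v
    ⊆R[y,-] {u} {v} u∈W u⊆v =
      mono y v y u (u∈R[u,v] isTransit y v) (proj₂ (x∈p∩q⁻ W _ (u⊆v (x∈p∩q⁺ (u∈W , v∈R[u,v] isTransit y u)))))

  singleton-properFor : ∀ {W} → 3 ≤ ∣ W ∣ → ∀ x → ProperFor R W (x , x)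
  singleton-properFor {W} 3≤∣W∣ x = subst (λ q → ∃ λ u → u ∈ W × u ∉ q) (sym (proj₂ (proj₂ isTransit) x))
    (∣q∣<∣p∣⇒p⊈q (subst (_< ∣ W ∣) (sym (∣⁅x⁆∣≡1 x)) (≤-trans (s≤s (s≤s z≤n)) 3≤∣W∣)))

  totallyBalanced⇒hc : TotallyBalanced (𝒞 R) → HC R
  totallyBalanced⇒hc acyclic W 3≤∣W∣
    with ∣q∣<∣p∣⇒p⊈q {p = W} {q = ⊥} (subst (_< ∣ W ∣) (sym (∣⊥∣≡0 N)) (≤-trans (s≤s z≤n) 3≤∣W∣))
  ... | x , _ with nestPointOutside R acyclic W (x , x) (singleton-properFor 3≤∣W∣ x)
  ... | y , y∈W , _ , y-nest with nestPointOutside R acyclic W (y , y) (singleton-properFor 3≤∣W∣ y)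
  ... | z , z∈W , z∉R[y,y] , z-nest =
    y , z , y∈W , z∈W , (λ y≡z → z∉R[y,y] (subst (_∈ R y y) y≡z (u∈R[u,v] isTransit y y))) ,
    nestPoint⇒comparable y-nest , nestPoint⇒comparable z-nest

mainTheorem3 : (n : ℕ) (R : TransitMap (suc n)) →
    IsTransitFunction R → IsMonotone R →
    (TB R ⇔ HC R) × (TB R ⇔ TB' R) × (TB R ⇔ TotallyBalanced (𝒞 R))
mainTheorem3 n R isTransit mono =
  mk⇔ (acyclic⇒hc ∘ tb⇒acyclic) hc⇒tb ,
  mk⇔ (acyclic⇒tb′ ∘ tb⇒acyclic) (acyclic⇒tb ∘ tb'⇒totallyBalanced mono) ,
  mk⇔ tb⇒acyclic acyclic⇒tb
  where
  tb⇒acyclic : TB R → TotallyBalanced (𝒞 R)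
  tb⇒acyclic = tb⇒totallyBalanced isTransit mono
  acyclic⇒hc : TotallyBalanced (𝒞 R) → HC R
  acyclic⇒hc = totallyBalanced⇒hc isTransit mono
  acyclic⇒tb : TotallyBalanced (𝒞 R) → TB R
  acyclic⇒tb = hc⇒tb ∘ acyclic⇒hc
  acyclic⇒tb′ : TotallyBalanced (𝒞 R) → TB' R
  acyclic⇒tb′ acyclic k v _ = totallyBalanced⇒chord isTransit acyclic k v
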